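{- For any matroid $M$ on a finite ground set $E$, $$F(M,\mathbf{x})=\sum_{B\in\mathcal{B}(M)}F(P_B,\gamma_B,\mathbf{x}),$$ where $\gamma_B$ is any strict labelling of the poset $P_B$.
   Context: For a matroid $M$ on finite ground set $E$ with bases $\mathcal{B}(M)$ and $f:E\to\mathbb{P}=\{1,2,\ldots\}$, $f$ is $M$-generic if the minimum of $f(B)=\sum_{e\in B}f(e)$ over bases is attained by a unique base; $F(M,\mathbf{x})=\sum_{f\ M\text{ -generic}}\prod_{e\in E}x_{f(e)}$. For a base $B$, $P_B$ is the poset on $E$ in which $e<e'$ if and only if $e\in B$, $e'\notin B$ and $(B\setminus\{e\})\cup\{e'\}$ is a base of $M$ (a poset of height at most one, elements of $B$ below elements of $E\setminus B$). A labelled poset $(P,\gamma)$ on $n$ elements is a poset with a bijection $\gamma:P\to\{1,\ldots,n\}$; $\gamma$ is strict if $\gamma(p)>\gamma(p')$ whenever $p<p'$. A $(P,\gamma)$-partition is $f:P\to\mathbb{P}$ with $f(p)\le f(p')$ whenever $p\le p'$, and $f(p)<f(p')$ whenever $p\le p'$ and $\gamma(p)>\gamma(p')$. $F(P,\gamma,\mathbf{x})=\sum_f\prod_{p\in P}x_{f(p)}$, summed over all $(P,\gamma)$-partitions $f$. -}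

module Defs where

open import Data.Nat as ℕ using (ℕ; zero; suc; _+_; _<_; _≤_)
import Data.Nat.Properties as ℕP
open import Data.Bool using (Bool; true; false; if_then_else_; T)
open import Data.Fin as Fin using (Fin; toℕ)
import Data.Fin.Properties as FinP
open import Data.Fin.Subset using (Subset; _∈_; _∉_; _-_; _∪_; ⁅_⁆; inside; outside)
open import Data.Fin.Subset.Properties using (_∈?_; anySubset?)
open import Data.Fin.Permutation using (Permutation′; _⟨$⟩ʳ_)
open import Data.List using (List; []; _∷_; map; concatMap; filter; length; allFin)
open import Data.Nat.ListAction using (sum)
open import Data.Vec using (Vec; []; _∷_)
import Data.Vec
import Data.Bool
import Data.Vec.Properties as VecP
import Data.Vec.Functional as VF
open import Data.Product using (Σ; ∃; _×_; _,_; proj₁; proj₂)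
import Data.Empty
import Data.Sum
open import Data.Sum using (_⊎_; inj₁; inj₂)
open import Relation.Binary.PropositionalEquality using (_≡_; _≢_; refl)
open import Relation.Nullary using (Dec; yes; no; ¬_)
open import Relation.Nullary.Decidable using (_×-dec_; _⊎-dec_; ¬?; _→-dec_)
open import Relation.Unary using (Pred; Decidable)

record Matroid (n : ℕ) : Set where
  field
    isBase   : Subset n → Bool
  IsBase : Subset n → Set
  IsBase B = T (isBase B)
  field
    base-exists : ∃ λ B → IsBase B
    exchange : ∀ B₁ B₂ → IsBase B₁ → IsBase B₂ →
               ∀ x → x ∈ B₁ → x ∉ B₂ →
               ∃ λ y → y ∈ B₂ × y ∉ B₁ × IsBase ((B₁ - x) ∪ ⁅ y ⁆)

open Matroid public

-- Maps f : E → [N].  An element i : Fin N stands for the positive integer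
-- toℕ i + 1, so a map Fin n → Fin N is a map E → {1,…,N} ⊆ ℙ.

val : ∀ {N} → Fin N → ℕ
val i = suc (toℕ i)

weight : ∀ {n N} → (Fin n → Fin N) → Subset n → ℕ
weight {n} f B = sum (map (λ e → if Data.Vec.lookup B e then val (f e) else 0) (allFin n))

Generic : ∀ {n N} → Matroid n → (Fin n → Fin N) → Set
Generic M f = ∃ λ B → IsBase M B ×
  (∀ B′ → IsBase M B′ → B′ ≢ B → weight f B < weight f B′)

_<[_,_]_ : ∀ {n} → Fin n → Matroid n → Subset n → Fin n → Set
e <[ M , B ] e′ = e ∈ B × e′ ∉ B × IsBase M ((B - e) ∪ ⁅ e′ ⁆)

_≤[_,_]_ : ∀ {n} → Fin n → Matroid n → Subset n → Fin n → Set
e ≤[ M , B ] e′ = e ≡ e′ ⊎ e <[ M , B ] e′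

StrictLabelling : ∀ {n} → Matroid n → Subset n → Permutation′ n → Set
StrictLabelling M B γ = ∀ p p′ → p <[ M , B ] p′ → γ ⟨$⟩ʳ p′ Fin.< γ ⟨$⟩ʳ p

PPartition : ∀ {n N} → Matroid n → Subset n → Permutation′ n → (Fin n → Fin N) → Set
PPartition M B γ f = ∀ p p′ → p ≤[ M , B ] p′ →
  (val (f p) ≤ val (f p′)) × (γ ⟨$⟩ʳ p′ Fin.< γ ⟨$⟩ʳ p → val (f p) < val (f p′))

-- Content of f: α_i = |f⁻¹(i)|, i.e. f contributes the monomial ∏_i x_i^{α_i}.

content : ∀ {n N} → (Fin n → Fin N) → Fin N → ℕ
content {n} f i = length (filter (λ e → f e FinP.≟ i) (allFin n))

HasContent : ∀ {n N} → (Fin n → Fin N) → (Fin N → ℕ) → Set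
HasContent f α = ∀ i → content f i ≡ α i

allFuns : (n N : ℕ) → List (Fin n → Fin N)
allFuns zero    N = (λ ()) ∷ []
allFuns (suc n) N = concatMap (λ i → map (λ g → i VF.∷ g) (allFuns n N)) (allFin N)

allSubsets : (n : ℕ) → List (Subset n)
allSubsets zero    = [] ∷ []
allSubsets (suc n) = concatMap (λ s → map (s ∷_) (allSubsets n)) (inside ∷ outside ∷ [])

countFuns : ∀ {p} {n N} {P : Pred (Fin n → Fin N) p} → Decidable P → ℕ
countFuns {n = n} {N} P? = length (filter P? (allFuns n N))

private
  all-sub? : ∀ {n p} {P : Pred (Subset n) p} → Decidable P → Dec (∀ B → P B)
  all-sub? {P = P} P? with anySubset? (λ B → ¬? (P? B))
  ... | yes (B , ¬PB) = no λ h → ¬PB (h B)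
  ... | no ¬∃ = yes λ B → Data.Sum.[ (λ ()) , (λ x → x) ] (aux B)
    where
    aux : ∀ B → Data.Empty.⊥ ⊎ P B
    aux B with P? B
    ... | yes pb = inj₂ pb
    ... | no ¬pb = Data.Empty.⊥-elim (¬∃ (B , ¬pb))

  T? : ∀ b → Dec (T b)
  T? = Data.Bool.T?

  sub≟ : ∀ {n} (A B : Subset n) → Dec (A ≡ B)
  sub≟ = VecP.≡-dec Data.Bool._≟_

generic? : ∀ {n N} (M : Matroid n) → Decidable (Generic {n} {N} M)
generic? M f = anySubset? λ B → T? (isBase M B) ×-dec
  all-sub? λ B′ → T? (isBase M B′) →-dec ((¬? (sub≟ B′ _)) →-dec (_ ℕP.<? _))

lt? : ∀ {n} (M : Matroid n) B (e e′ : Fin n) → Dec (e <[ M , B ] e′)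
lt? M B e e′ = (e ∈? B) ×-dec (¬? (e′ ∈? B)) ×-dec T? (isBase M _)

partition? : ∀ {n N} (M : Matroid n) B γ → Decidable (PPartition {n} {N} M B γ)
partition? M B γ f = FinP.all? λ p → FinP.all? λ p′ →
  ((p FinP.≟ p′) ⊎-dec lt? M B p p′) →-dec
    ((_ ℕP.≤? _) ×-dec ((_ FinP.<? _) →-dec (_ ℕP.<? _)))

hasContent? : ∀ {n N} (α : Fin N → ℕ) → Decidable (λ (f : Fin n → Fin N) → HasContent f α)
hasContent? α f = FinP.all? λ i → _ ℕP.≟ _

-- Coefficient of x^α in F(M, x), for α supported on {1,…,N}:
-- the number of M-generic f with content α (such f take values ≤ N).

coeffF-M : ∀ {n} → Matroid n → (N : ℕ) → (Fin N → ℕ) → ℕ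
coeffF-M M N α = countFuns {N = N} (λ f → generic? M f ×-dec hasContent? α f)

-- Coefficient of x^α in F(P_B, γ, x).
coeffF-P : ∀ {n} → Matroid n → Subset n → Permutation′ n → (N : ℕ) → (Fin N → ℕ) → ℕ
coeffF-P M B γ N α = countFuns {N = N} (λ f → partition? M B γ f ×-dec hasContent? α f)

sumBases : ∀ {n} → Matroid n → (Subset n → ℕ) → ℕ
sumBases {n} M g = sum (map (λ B → if isBase M B then g B else 0) (allSubsets n))

{-# OPTIONS --safe #-}
module Submission where

-- A base B is the unique f-minimal base exactly when f strictly increases along every
-- covering relation e <_B e′ of P_B.  One direction compares f(B) with f((B ∖ e) ∪ e′).
-- For the other, take a base B′ ≠ B and a heaviest x₀ ∈ B ∖ B′; exchange gives y ∈ B′ ∖ B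
-- with x₀ <_B y, and exchanging y back out of B′ brings in some x ∈ B ∖ B′ with
-- f(x) ≤ f(x₀) < f(y): a strictly lighter base one step closer to B, so induction on
-- |B′ ∖ B| shows f(B) < f(B′).  For a strict labelling the (P_B, γ_B)-partitions are
-- exactly the f strictly increasing on P_B, so an M-generic f is a (P_B, γ_B)-partition
-- for exactly one base B and a non-generic f for none; summing over the pairs (f, B) in
-- both orders gives the identity coefficientwise.

open import Defs
open import Data.Nat using (ℕ)
open import Data.Fin using (Fin)
open import Data.Fin.Subset using (Subset)
open import Data.Fin.Permutation using (Permutation′)
open import Relation.Binary.PropositionalEquality using (_≡_)

open import Data.Nat using (zero; suc; _+_; _<_; _≤_)
import Data.Nat.Properties as ℕP
open import Data.Bool using (true; false; T?; if_then_else_)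
import Data.Bool.Properties as BoolP
open import Data.Fin using (zero; suc; punchIn)
import Data.Fin.Properties as FinP
open import Data.Fin.Subset using (_∈_; _∉_; _⊆_; _-_; _∪_; ⁅_⁆; inside; outside)
open import Data.Fin.Subset.Properties
  using (_∈?_; anySubset?; ⊆-antisym; x∈p∪q⁺; x∈⁅x⁆; p─q⊆p; p─⊥≡p; ∪-identityʳ)
open import Data.List using (List; []; _∷_; _++_; map; filter; length; allFin; tabulate)
import Data.List.Properties as ListP
open import Data.List.Relation.Unary.All as All using ()
open import Data.List.Relation.Unary.All.Properties using (all-filter)
open import Data.List.Membership.Propositional.Properties using (∈-allFin; ∈-filter⁺)
open import Data.List.Extrema.Nat using (argmax; argmax-all; f[xs]≤f[argmax])
open import Data.Nat.ListAction using (sum)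
open import Data.Nat.ListAction.Properties using (sum-++)
open import Data.Vec using (lookup; []; _∷_)
import Data.Vec.Properties as VecP
open import Data.Vec.Functional using (removeAt)
open import Data.Product using (∃; _×_; _,_; proj₂)
open import Data.Sum using (_⊎_; inj₁; inj₂)
open import Relation.Binary.PropositionalEquality
  using (_≢_; refl; sym; trans; cong; cong₂; subst; module ≡-Reasoning)
open import Relation.Nullary using (Dec; yes; no; ¬_; does; contradiction)
open import Relation.Nullary.Decidable using (_×-dec_; ¬?; decidable-stable)
open import Relation.Unary using (Pred; Decidable)
open import Function using (_∘_; flip; case_of_)
open import Algebra.Properties.CommutativeSemigroup ℕP.+-commutativeSemigroup
  using (interchange; xy∙z≈zy∙x; xy∙z≈xz∙y)
import Algebra.Properties.CommutativeMonoid.Sum ℕP.+-0-commutativeMonoid as ∑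

χ : ∀ {p} {P : Set p} → Dec P → ℕ
χ P? = if does P? then 1 else 0

χ-cong : ∀ {p q} {P : Set p} {Q : Set q} (P? : Dec P) (Q? : Dec Q) →
         (P → Q) → (Q → P) → χ P? ≡ χ Q?
χ-cong (yes _) (yes _) _   _   = refl
χ-cong (no _)  (no _)  _   _   = refl
χ-cong (yes p) (no ¬q) P→Q _   = contradiction (P→Q p) ¬q
χ-cong (no ¬p) (yes q) _   Q→P = contradiction (Q→P q) ¬p

χ-yes : ∀ {p} {P : Set p} (P? : Dec P) → P → χ P? ≡ 1
χ-yes (yes _) _ = refl
χ-yes (no ¬p) p = contradiction p ¬p

χ-no : ∀ {p} {P : Set p} (P? : Dec P) → ¬ P → χ P? ≡ 0
χ-no (yes p) ¬p = contradiction p ¬p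
χ-no (no _)  _  = refl

length-filter≡sum-χ : ∀ {a p} {A : Set a} {P : Pred A p} (P? : Decidable P) (xs : List A) →
                      length (filter P? xs) ≡ sum (map (χ ∘ P?) xs)
length-filter≡sum-χ P? []       = refl
length-filter≡sum-χ P? (x ∷ xs) with P? x
... | yes _ = cong suc (length-filter≡sum-χ P? xs)
... | no  _ = length-filter≡sum-χ P? xs

module _ {a} {A : Set a} where

  sum-map-cong : ∀ {g h : A → ℕ} (xs : List A) → (∀ x → g x ≡ h x) →
                 sum (map g xs) ≡ sum (map h xs)
  sum-map-cong xs g≗h = cong sum (ListP.map-cong g≗h xs)

  sum-map-zero : ∀ {g : A → ℕ} (xs : List A) → (∀ x → g x ≡ 0) → sum (map g xs) ≡ 0
  sum-map-zero []       _   = refl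
  sum-map-zero (x ∷ xs) g≡0 = cong₂ _+_ (g≡0 x) (sum-map-zero xs g≡0)

  sum-map-+ : ∀ (g h : A → ℕ) xs →
              sum (map (λ x → g x + h x) xs) ≡ sum (map g xs) + sum (map h xs)
  sum-map-+ g h []       = refl
  sum-map-+ g h (x ∷ xs) =
    trans (cong (g x + h x +_) (sum-map-+ g h xs)) (interchange (g x) (h x) _ _)

sum-χ-T?-×-dec : ∀ {a p} {A : Set a} {P : Pred A p} b (P? : Decidable P) (xs : List A) →
                 sum (map (λ x → χ (T? b ×-dec P? x)) xs) ≡ (if b then length (filter P? xs) else 0)
sum-χ-T?-×-dec true  P? xs = sym (length-filter≡sum-χ P? xs)
sum-χ-T?-×-dec false P? xs = sum-map-zero xs (λ _ → refl)

sum-map-comm : ∀ {a c} {A : Set a} {C : Set c} (k : A → C → ℕ) xs ys →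
               sum (map (λ x → sum (map (k x) ys)) xs) ≡ sum (map (λ y → sum (map (λ x → k x y) xs)) ys)
sum-map-comm k []       ys = sym (sum-map-zero ys (λ _ → refl))
sum-map-comm k (x ∷ xs) ys =
  trans (cong (sum (map (k x) ys) +_) (sum-map-comm k xs ys)) (sym (sum-map-+ (k x) _ ys))

sum-allSubsets-suc : ∀ {n} (h : Subset (suc n) → ℕ) →
  sum (map h (allSubsets (suc n))) ≡
  sum (map (h ∘ (inside ∷_)) (allSubsets n)) + sum (map (h ∘ (outside ∷_)) (allSubsets n))
sum-allSubsets-suc {n} h = begin
  sum (map h (I ++ O ++ []))             ≡⟨ cong sum (ListP.map-++ h I (O ++ [])) ⟩
  sum (map h I ++ map h (O ++ []))       ≡⟨ sum-++ (map h I) (map h (O ++ [])) ⟩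
  sum (map h I) + sum (map h (O ++ []))  ≡⟨ cong (λ ys → sum (map h I) + sum (map h ys)) (ListP.++-identityʳ O) ⟩
  sum (map h I) + sum (map h O)          ≡⟨ cong₂ _+_ (cong sum (ListP.map-∘ (allSubsets n)))
                                                      (cong sum (ListP.map-∘ (allSubsets n))) ⟨
  sum (map (h ∘ (inside ∷_)) (allSubsets n)) + sum (map (h ∘ (outside ∷_)) (allSubsets n)) ∎
  where
  open ≡-Reasoning
  I O : List (Subset (suc n))
  I = map (inside ∷_) (allSubsets n)
  O = map (outside ∷_) (allSubsets n)

sum-allSubsets-single : ∀ {n} (h : Subset n → ℕ) B₀ → (∀ B → B ≢ B₀ → h B ≡ 0) →
                        sum (map h (allSubsets n)) ≡ h B₀
sum-allSubsets-single {zero}  h []             _   = ℕP.+-identityʳ (h [])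
sum-allSubsets-single {suc n} h (inside ∷ B₀)  h≡0 = begin
  sum (map h (allSubsets (suc n)))                                  ≡⟨ sum-allSubsets-suc h ⟩
  sum (map (h ∘ (inside ∷_)) Bs) + sum (map (h ∘ (outside ∷_)) Bs)  ≡⟨ cong₂ _+_
    (sum-allSubsets-single (h ∘ (inside ∷_)) B₀ (λ B B≢B₀ → h≡0 (inside ∷ B) (B≢B₀ ∘ VecP.∷-injectiveʳ)))
    (sum-map-zero Bs (λ B → h≡0 (outside ∷ B) λ ())) ⟩
  h (inside ∷ B₀) + 0                                               ≡⟨ ℕP.+-identityʳ _ ⟩
  h (inside ∷ B₀)                                                   ∎
  where
  open ≡-Reasoning
  Bs : List (Subset n)
  Bs = allSubsets n
sum-allSubsets-single {suc n} h (outside ∷ B₀) h≡0 = begin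
  sum (map h (allSubsets (suc n)))                                  ≡⟨ sum-allSubsets-suc h ⟩
  sum (map (h ∘ (inside ∷_)) Bs) + sum (map (h ∘ (outside ∷_)) Bs)  ≡⟨ cong₂ _+_
    (sum-map-zero Bs (λ B → h≡0 (inside ∷ B) λ ()))
    (sum-allSubsets-single (h ∘ (outside ∷_)) B₀ (λ B B≢B₀ → h≡0 (outside ∷ B) (B≢B₀ ∘ VecP.∷-injectiveʳ))) ⟩
  h (outside ∷ B₀)                                                  ∎
  where
  open ≡-Reasoning
  Bs : List (Subset n)
  Bs = allSubsets n

sum-allSubsets-χ-unique : ∀ {n p} {P : Pred (Subset n) p} (P? : Decidable P) (∃P? : Dec (∃ P)) →
                          (∀ {B B′} → P B → P B′ → B ≡ B′) →
                          χ ∃P? ≡ sum (map (χ ∘ P?) (allSubsets n))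
sum-allSubsets-χ-unique P? (yes (B₀ , PB₀)) unique = sym (trans
  (sum-allSubsets-single (χ ∘ P?) B₀ (λ B B≢B₀ → χ-no (P? B) (B≢B₀ ∘ flip unique PB₀)))
  (χ-yes (P? B₀) PB₀))
sum-allSubsets-χ-unique P? (no ¬∃P) _ =
  sym (sum-map-zero (allSubsets _) (λ B → χ-no (P? B) (λ PB → ¬∃P (B , PB))))

restrict : ∀ {n} → (Fin n → ℕ) → Subset n → Fin n → ℕ
restrict v B e = if lookup B e then v e else 0

restrict-inside : ∀ {n} (v : Fin n → ℕ) B {x} → lookup B x ≡ inside → restrict v B x ≡ v x
restrict-inside v B {x} = cong (λ b → if b then v x else 0)

restrict-outside : ∀ {n} (v : Fin n → ℕ) B {x} → lookup B x ≡ outside → restrict v B x ≡ 0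
restrict-outside v B {x} = cong (λ b → if b then v x else 0)

subsetSum : ∀ {n} → (Fin n → ℕ) → Subset n → ℕ
subsetSum {n} v B = sum (map (restrict v B) (allFin n))

[∉_] : ∀ {n} → Subset n → Fin n → ℕ
[∉ B ] e = if lookup B e then 0 else 1

-- A subset sum, so that subsetSum-exchange also tracks how |B′ ∖ B| changes.
∣_∖_∣ : ∀ {n} → Subset n → Subset n → ℕ
∣ B′ ∖ B ∣ = subsetSum [∉ B ] B′

∉⇒lookup≡outside : ∀ {n} {p : Subset n} {x} → x ∉ p → lookup p x ≡ outside
∉⇒lookup≡outside {p = p} {x} x∉p with lookup p x in eq
... | inside  = contradiction (VecP.lookup⇒[]= x p eq) x∉p
... | outside = refl

lookup[p-x]x≡outside : ∀ {n} (p : Subset n) x → lookup (p - x) x ≡ outside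
lookup[p-x]x≡outside (_ ∷ p) zero    = refl
lookup[p-x]x≡outside (_ ∷ p) (suc x) = lookup[p-x]x≡outside p x

lookup[p-x]-≢ : ∀ {n} (p : Subset n) {x e} → e ≢ x → lookup (p - x) e ≡ lookup p e
lookup[p-x]-≢ (_ ∷ p) {zero}  {zero}  0≢0  = contradiction refl 0≢0
lookup[p-x]-≢ (_ ∷ p) {zero}  {suc e} _    = cong (λ q → lookup q e) (p─⊥≡p p)
lookup[p-x]-≢ (_ ∷ p) {suc x} {zero}  _    = refl
lookup[p-x]-≢ (_ ∷ p) {suc x} {suc e} e≢x  = lookup[p-x]-≢ p (e≢x ∘ cong suc)

lookup[p∪⁅x⁆]x≡inside : ∀ {n} (p : Subset n) x → lookup (p ∪ ⁅ x ⁆) x ≡ inside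
lookup[p∪⁅x⁆]x≡inside (b ∷ p) zero    = BoolP.∨-zeroʳ b
lookup[p∪⁅x⁆]x≡inside (_ ∷ p) (suc x) = lookup[p∪⁅x⁆]x≡inside p x

lookup[p∪⁅x⁆]-≢ : ∀ {n} (p : Subset n) {x e} → e ≢ x → lookup (p ∪ ⁅ x ⁆) e ≡ lookup p e
lookup[p∪⁅x⁆]-≢ (_ ∷ p) {zero}  {zero}  0≢0 = contradiction refl 0≢0
lookup[p∪⁅x⁆]-≢ (_ ∷ p) {zero}  {suc e} _   = cong (λ q → lookup q e) (∪-identityʳ p)
lookup[p∪⁅x⁆]-≢ (b ∷ p) {suc x} {zero}  _   = BoolP.∨-identityʳ b
lookup[p∪⁅x⁆]-≢ (_ ∷ p) {suc x} {suc e} e≢x = lookup[p∪⁅x⁆]-≢ p (e≢x ∘ cong suc)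

sum-allFin : ∀ {n} (g : Fin n → ℕ) → sum (map g (allFin n)) ≡ ∑.sum g
sum-allFin g = trans (cong sum (ListP.map-tabulate (λ i → i) g)) (sum-tabulate g)
  where
  sum-tabulate : ∀ {n} (g : Fin n → ℕ) → sum (tabulate g) ≡ ∑.sum g
  sum-tabulate {zero}  g = refl
  sum-tabulate {suc n} g = cong (g zero +_) (sum-tabulate (g ∘ suc))

∑-update : ∀ {n} (g h : Fin n → ℕ) a → (∀ e → e ≢ a → g e ≡ h e) →
           ∑.sum g + h a ≡ ∑.sum h + g a
∑-update {suc n} g h a g≡h = begin
  ∑.sum g + h a                           ≡⟨ cong (_+ h a) (∑.sum-remove {i = a} g) ⟩
  g a + ∑.sum (removeAt g a) + h a        ≡⟨ cong (λ s → g a + s + h a) (∑.sum-cong-≗ g≡h-off-a) ⟩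
  g a + ∑.sum (removeAt h a) + h a        ≡⟨ xy∙z≈zy∙x (g a) _ (h a) ⟩
  h a + ∑.sum (removeAt h a) + g a        ≡⟨ cong (_+ g a) (∑.sum-remove {i = a} h) ⟨
  ∑.sum h + g a                           ∎
  where
  open ≡-Reasoning
  g≡h-off-a : ∀ i → g (punchIn a i) ≡ h (punchIn a i)
  g≡h-off-a i = g≡h (punchIn a i) (FinP.punchInᵢ≢i a i)

subsetSum-update : ∀ {n} (v : Fin n → ℕ) {B B′ : Subset n} a →
                   (∀ e → e ≢ a → lookup B e ≡ lookup B′ e) →
                   subsetSum v B + restrict v B′ a ≡ subsetSum v B′ + restrict v B a
subsetSum-update v {B} {B′} a B≡B′ = begin
  subsetSum v B + restrict v B′ a          ≡⟨ cong (_+ restrict v B′ a) (sum-allFin (restrict v B)) ⟩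
  ∑.sum (restrict v B) + restrict v B′ a   ≡⟨ ∑-update _ _ a (λ e → cong (λ b → if b then v e else 0) ∘ B≡B′ e) ⟩
  ∑.sum (restrict v B′) + restrict v B a   ≡⟨ cong (_+ restrict v B a) (sum-allFin (restrict v B′)) ⟨
  subsetSum v B′ + restrict v B a          ∎
  where open ≡-Reasoning

subsetSum-remove : ∀ {n} (v : Fin n → ℕ) {B : Subset n} {y} → y ∈ B →
                   subsetSum v (B - y) + v y ≡ subsetSum v B
subsetSum-remove v {B} {y} y∈B = begin
  subsetSum v (B - y) + v y
    ≡⟨ cong (subsetSum v (B - y) +_) (restrict-inside v B (VecP.[]=⇒lookup y∈B)) ⟨
  subsetSum v (B - y) + restrict v B y
    ≡⟨ subsetSum-update v {B - y} {B} y (λ e → lookup[p-x]-≢ B) ⟩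
  subsetSum v B + restrict v (B - y) y
    ≡⟨ cong (_ +_) (restrict-outside v (B - y) (lookup[p-x]x≡outside B y)) ⟩
  subsetSum v B + 0                     ≡⟨ ℕP.+-identityʳ _ ⟩
  subsetSum v B                         ∎
  where open ≡-Reasoning

subsetSum-insert : ∀ {n} (v : Fin n → ℕ) {B : Subset n} {x} → x ∉ B →
                   subsetSum v (B ∪ ⁅ x ⁆) ≡ subsetSum v B + v x
subsetSum-insert v {B} {x} x∉B = begin
  subsetSum v (B ∪ ⁅ x ⁆)                   ≡⟨ ℕP.+-identityʳ _ ⟨
  subsetSum v (B ∪ ⁅ x ⁆) + 0
    ≡⟨ cong (subsetSum v (B ∪ ⁅ x ⁆) +_) (restrict-outside v B (∉⇒lookup≡outside x∉B)) ⟨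
  subsetSum v (B ∪ ⁅ x ⁆) + restrict v B x
    ≡⟨ subsetSum-update v {B ∪ ⁅ x ⁆} {B} x (λ e → lookup[p∪⁅x⁆]-≢ B) ⟩
  subsetSum v B + restrict v (B ∪ ⁅ x ⁆) x
    ≡⟨ cong (_ +_) (restrict-inside v (B ∪ ⁅ x ⁆) (lookup[p∪⁅x⁆]x≡inside B x)) ⟩
  subsetSum v B + v x                       ∎
  where open ≡-Reasoning

subsetSum-exchange : ∀ {n} (v : Fin n → ℕ) {B : Subset n} {x y} → y ∈ B → x ∉ B →
                     subsetSum v ((B - y) ∪ ⁅ x ⁆) + v y ≡ subsetSum v B + v x
subsetSum-exchange v {B} {x} {y} y∈B x∉B = begin
  subsetSum v ((B - y) ∪ ⁅ x ⁆) + v y   ≡⟨ cong (_+ v y) (subsetSum-insert v (x∉B ∘ p─q⊆p B ⁅ y ⁆)) ⟩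
  subsetSum v (B - y) + v x + v y       ≡⟨ xy∙z≈xz∙y _ (v x) (v y) ⟩
  subsetSum v (B - y) + v y + v x       ≡⟨ cong (_+ v x) (subsetSum-remove v y∈B) ⟩
  subsetSum v B + v x                   ∎
  where open ≡-Reasoning

⊆-or-∃∉ : ∀ {n} (p q : Subset n) → p ⊆ q ⊎ ∃ λ x → x ∈ p × x ∉ q
⊆-or-∃∉ p q with FinP.any? (λ x → x ∈? p ×-dec ¬? (x ∈? q))
... | yes x∈p∖q = inj₂ x∈p∖q
... | no  ∄x    = inj₁ λ {x} x∈p → decidable-stable (x ∈? q) (λ x∉q → ∄x (x , x∈p , x∉q))

≢⇒∃∉ : ∀ {n} {p q : Subset n} → p ≢ q → (∃ λ x → x ∈ p × x ∉ q) ⊎ (∃ λ x → x ∈ q × x ∉ p)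
≢⇒∃∉ {p = p} {q} p≢q with ⊆-or-∃∉ p q | ⊆-or-∃∉ q p
... | inj₂ x∈p∖q | _          = inj₁ x∈p∖q
... | inj₁ _     | inj₂ x∈q∖p = inj₂ x∈q∖p
... | inj₁ p⊆q   | inj₁ q⊆p   = contradiction (⊆-antisym p⊆q q⊆p) p≢q

argmax-Fin : ∀ {n p} {P : Pred (Fin n) p} → Decidable P → (g : Fin n → ℕ) → ∃ P →
             ∃ λ m → P m × (∀ {y} → P y → g y ≤ g m)
argmax-Fin {n} P? g (x , Px) =
  argmax g x xs ,
  argmax-all g Px (all-filter P? (allFin n)) ,
  λ Py → All.lookup (f[xs]≤f[argmax] {f = g} x xs) (∈-filter⁺ P? (∈-allFin _) Py)
  where
  xs : List (Fin n)
  xs = filter P? (allFin n)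

_≟ₛ_ : ∀ {n} (p q : Subset n) → Dec (p ≡ q)
_≟ₛ_ = VecP.≡-dec BoolP._≟_

module _ {n : ℕ} (M : Matroid n) where

  IsUniqueMinBase : ∀ {N} → (Fin n → Fin N) → Subset n → Set
  IsUniqueMinBase f B = IsBase M B × (∀ B′ → IsBase M B′ → B′ ≢ B → weight f B < weight f B′)

  StrictlyIncreasing : ∀ {N} → Subset n → (Fin n → Fin N) → Set
  StrictlyIncreasing B f = ∀ {e e′} → e <[ M , B ] e′ → val (f e) < val (f e′)

  IsUniqueMinBase-unique : ∀ {N} {f : Fin n → Fin N} {B B′} →
                           IsUniqueMinBase f B → IsUniqueMinBase f B′ → B ≡ B′
  IsUniqueMinBase-unique {B = B} {B′} (b , minimal) (b′ , minimal′) =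
    decidable-stable (B ≟ₛ B′) λ B≢B′ →
      ℕP.<-asym (minimal B′ b′ (B≢B′ ∘ sym)) (minimal′ B b B≢B′)

  base-difference : ∀ {B B′} → IsBase M B → IsBase M B′ → B′ ≢ B → ∃ λ x → x ∈ B × x ∉ B′
  base-difference {B} {B′} b b′ B′≢B with ≢⇒∃∉ (B′≢B ∘ sym)
  ... | inj₁ x∈B∖B′              = x∈B∖B′
  ... | inj₂ (y , y∈B′ , y∉B) with exchange M B′ B b′ b y y∈B′ y∉B
  ...   | x , x∈B , x∉B′ , _     = x , x∈B , x∉B′

  uniqueMin⇒increasing : ∀ {N} {f : Fin n → Fin N} {B} → IsUniqueMinBase f B → StrictlyIncreasing B f
  uniqueMin⇒increasing {f = f} {B} (_ , minimal) {e} {e′} (e∈B , e′∉B , B-e+e′) =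
    ℕP.+-cancelˡ-< (weight f B) _ _ (begin-strict
      weight f B + val (f e)                 <⟨ ℕP.+-monoˡ-< (val (f e)) (minimal _ B-e+e′ B-e+e′≢B) ⟩
      weight f ((B - e) ∪ ⁅ e′ ⁆) + val (f e) ≡⟨ subsetSum-exchange (val ∘ f) e∈B e′∉B ⟩
      weight f B + val (f e′)                ∎)
    where
    open ℕP.≤-Reasoning
    B-e+e′≢B : (B - e) ∪ ⁅ e′ ⁆ ≢ B
    B-e+e′≢B eq = e′∉B (subst (e′ ∈_) eq (x∈p∪q⁺ (inj₂ (x∈⁅x⁆ e′))))

  exchange-towards : ∀ {N} {f : Fin n → Fin N} {B B′} → IsBase M B → StrictlyIncreasing B f →
                     IsBase M B′ → B′ ≢ B →
                     ∃ λ B″ → IsBase M B″ × weight f B″ < weight f B′ × suc ∣ B″ ∖ B ∣ ≡ ∣ B′ ∖ B ∣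
  exchange-towards {f = f} {B} {B′} b increasing b′ B′≢B
    with argmax-Fin (λ x → x ∈? B ×-dec ¬? (x ∈? B′)) (val ∘ f) (base-difference b b′ B′≢B)
  ... | x₀ , (x₀∈B , x₀∉B′) , x₀-heaviest
    with exchange M B B′ b b′ x₀ x₀∈B x₀∉B′
  ... | y , y∈B′ , y∉B , B-x₀+y
    with exchange M B′ B b′ b y y∈B′ y∉B
  ... | x , x∈B , x∉B′ , B′-y+x = B″ , B′-y+x , lighter , closer
    where
    B″ : Subset n
    B″ = (B′ - y) ∪ ⁅ x ⁆

    fx<fy : val (f x) < val (f y)
    fx<fy = ℕP.≤-<-trans (x₀-heaviest (x∈B , x∉B′)) (increasing (x₀∈B , y∉B , B-x₀+y))

    lighter : weight f B″ < weight f B′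
    lighter = ℕP.+-cancelʳ-< (val (f y)) _ _ (begin-strict
      weight f B″ + val (f y)  ≡⟨ subsetSum-exchange (val ∘ f) y∈B′ x∉B′ ⟩
      weight f B′ + val (f x)  <⟨ ℕP.+-monoʳ-< (weight f B′) fx<fy ⟩
      weight f B′ + val (f y)  ∎)
      where open ℕP.≤-Reasoning

    closer : suc ∣ B″ ∖ B ∣ ≡ ∣ B′ ∖ B ∣
    closer = begin
      suc ∣ B″ ∖ B ∣          ≡⟨ ℕP.+-comm 1 _ ⟩
      ∣ B″ ∖ B ∣ + 1          ≡⟨ cong (λ b → ∣ B″ ∖ B ∣ + (if b then 0 else 1)) (∉⇒lookup≡outside y∉B) ⟨
      ∣ B″ ∖ B ∣ + [∉ B ] y   ≡⟨ subsetSum-exchange [∉ B ] y∈B′ x∉B′ ⟩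
      ∣ B′ ∖ B ∣ + [∉ B ] x   ≡⟨ cong (λ b → ∣ B′ ∖ B ∣ + (if b then 0 else 1)) (VecP.[]=⇒lookup x∈B) ⟩
      ∣ B′ ∖ B ∣ + 0          ≡⟨ ℕP.+-identityʳ _ ⟩
      ∣ B′ ∖ B ∣              ∎
      where open ≡-Reasoning

  increasing⇒uniqueMin : ∀ {N} {f : Fin n → Fin N} {B} → IsBase M B → StrictlyIncreasing B f →
                         IsUniqueMinBase f B
  increasing⇒uniqueMin {f = f} {B} b increasing = b , λ B′ → lighter-at ∣ B′ ∖ B ∣ B′ refl
    where
    lighter-at : ∀ d B′ → ∣ B′ ∖ B ∣ ≡ d → IsBase M B′ → B′ ≢ B → weight f B < weight f B′
    lighter-at zero B′ dist b′ B′≢B = case exchange-towards b increasing b′ B′≢B of λ where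
      (_ , _ , _ , closer) → contradiction (trans closer dist) ℕP.1+n≢0
    lighter-at (suc d) B′ dist b′ B′≢B = case exchange-towards b increasing b′ B′≢B of λ where
      (B″ , b″ , lighter , closer) → case B″ ≟ₛ B of λ where
        (yes refl)  → lighter
        (no B″≢B)   → ℕP.<-trans (lighter-at d B″ (ℕP.suc-injective (trans closer dist)) b″ B″≢B) lighter

module _ {n : ℕ} (M : Matroid n) {B : Subset n} {γ : Permutation′ n} {N} {f : Fin n → Fin N} where

  partition⇒increasing : StrictLabelling M B γ → PPartition M B γ f → StrictlyIncreasing M B f
  partition⇒increasing strict partition e<e′ = proj₂ (partition _ _ (inj₂ e<e′)) (strict _ _ e<e′)

  increasing⇒partition : StrictlyIncreasing M B f → PPartition M B γ f
  increasing⇒partition increasing p .p (inj₁ refl) =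
    ℕP.≤-refl , λ γp<γp → contradiction γp<γp (FinP.<-irrefl refl)
  increasing⇒partition increasing p p′ (inj₂ p<p′) = ℕP.<⇒≤ (increasing p<p′) , λ _ → increasing p<p′

module _ {n : ℕ} (M : Matroid n) (γ : Subset n → Permutation′ n) {N} (α : Fin N → ℕ) where

  IsPartitionBase : (Fin n → Fin N) → Subset n → Set
  IsPartitionBase f B = IsBase M B × PPartition M B (γ B) f × HasContent f α

  isPartitionBase? : ∀ f → Decidable (IsPartitionBase f)
  isPartitionBase? f B = T? (isBase M B) ×-dec (partition? M B (γ B) f ×-dec hasContent? α f)

  χ-generic≡sum-χ-partitionBase : (∀ B → IsBase M B → StrictLabelling M B (γ B)) → ∀ f →
    χ (generic? M f ×-dec hasContent? α f) ≡ sum (map (χ ∘ isPartitionBase? f) (allSubsets n))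
  χ-generic≡sum-χ-partitionBase strict f =
    trans (χ-cong (generic? M f ×-dec hasContent? α f) (anySubset? (isPartitionBase? f)) to from)
          (sum-allSubsets-χ-unique (isPartitionBase? f) (anySubset? (isPartitionBase? f)) unique)
    where
    partition⇒uniqueMin : ∀ {B} → IsBase M B → PPartition M B (γ B) f → IsUniqueMinBase M f B
    partition⇒uniqueMin {B} b partition =
      increasing⇒uniqueMin M b (partition⇒increasing M {γ = γ B} (strict B b) partition)

    to : Generic M f × HasContent f α → ∃ (IsPartitionBase f)
    to ((B , minimal@(b , _)) , content) =
      B , b , increasing⇒partition M {γ = γ B} (uniqueMin⇒increasing M minimal) , content

    from : ∃ (IsPartitionBase f) → Generic M f × HasContent f α
    from (B , b , partition , content) = (B , partition⇒uniqueMin b partition) , content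

    unique : ∀ {B B′} → IsPartitionBase f B → IsPartitionBase f B′ → B ≡ B′
    unique (b , partition , _) (b′ , partition′ , _) =
      IsUniqueMinBase-unique M (partition⇒uniqueMin b partition) (partition⇒uniqueMin b′ partition′)

theorem5p2 : ∀ {n} (M : Matroid n) (γ : Subset n → Permutation′ n) →
    (∀ B → IsBase M B → StrictLabelling M B (γ B)) →
    ∀ (N : ℕ) (α : Fin N → ℕ) →
    coeffF-M M N α ≡ sumBases M (λ B → coeffF-P M B (γ B) N α)
theorem5p2 {n} M γ strict N α = begin
  coeffF-M M N α                                                ≡⟨ length-filter≡sum-χ _ fs ⟩
  sum (map (λ f → χ (generic? M f ×-dec hasContent? α f)) fs)
    ≡⟨ sum-map-cong fs (χ-generic≡sum-χ-partitionBase M γ α strict) ⟩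
  sum (map (λ f → sum (map (λ B → χ (partitionBase? f B)) Bs)) fs)
    ≡⟨ sum-map-comm (λ f B → χ (partitionBase? f B)) fs Bs ⟩
  sum (map (λ B → sum (map (λ f → χ (partitionBase? f B)) fs)) Bs)
    ≡⟨ sum-map-cong Bs (λ B → sum-χ-T?-×-dec (isBase M B) _ fs) ⟩
  sumBases M (λ B → coeffF-P M B (γ B) N α)                     ∎
  where
  open ≡-Reasoning
  fs : List (Fin n → Fin N)
  fs = allFuns n N
  Bs : List (Subset n)
  Bs = allSubsets n
  partitionBase? : ∀ f → Decidable (IsPartitionBase M γ α f)
  partitionBase? = isPartitionBase? M γ α
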